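{- For each positive integer $c$, if a subset $U$ of $V(F_c)$ with $|U|\leq c$ contains no two vertices joined by a red edge, but intersects every red clique of the standard normal cover of $F_c$, then $|U|=c$ and $U$ has at least $c-1$ vertices in common with some blue clique of the standard normal cover of $F_c$.
   Context: A red-blue graph is a graph each of whose edges is colored red or blue. A normal cover of a red-blue graph is a pair $(\mathcal C,\mathcal S)$ where $\mathcal C$ is a set of blue cliques covering all vertices, $\mathcal S$ is a set of red cliques covering all vertices, and every member of $\mathcal C$ meets every member of $\mathcal S$. Red-blue graphs $F_c$ and their standard normal covers $(\mathcal C_c,\mathcal S_c)$ are defined recursively. $F_1$ is a single vertex $v$ with $\mathcal C_1=\mathcal S_1=\{\{v\}\}$. $F_2$ has vertices $0,1,v_1,v_2$, blue edges $0v_1$, $1v_2$, red edges $0v_2$, $1v_1$, and $\mathcal C_2=\{\{0,v_1\},\{1,v_2\}\}$, $\mathcal S_2=\{\{0,v_2\},\{1,v_1\}\}$. For $c\geq 3$, $F_c$ consists of five new vertices $A,B,C,D,E$ and five disjoint copies $F_{c-2}(A),\dots,F_{c-2}(E)$ of $F_{c-2}$ (with their colored edges). Among $A,\dots,E$: edges $AB,BC,CD,DE,EA$ are blue and $AC,AD,BD,BE,CE$ are red. Every vertex of $F_{c-2}(D)$ is joined by blue edges to $A,B$ and by red edges to $C,E$; every vertex of $F_{c-2}(E)$ blue to $B,C$ and red to $A,D$; of $F_{c-2}(A)$ blue to $C,D$ and red to $B,E$; of $F_{c-2}(B)$ blue to $D,E$ and red to $C,A$; of $F_{c-2}(C)$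 blue to $E,A$ and red to $D,B$. No other pairs are joined. The standard cover $\mathcal C_c$ consists of all sets $Q\cup\{X_1,X_2\}$ where $Q$ is a blue clique of the standard cover of some copy $F_{c-2}(Y)$ and $X_1,X_2$ are the two vertices of $\{A,\dots,E\}$ joined to that copy by blue edges; $\mathcal S_c$ consists of all sets $R\cup\{X_1,X_2\}$ where $R$ is a red clique of the standard cover of some copy $F_{c-2}(Y)$ and $X_1,X_2$ are the two vertices joined to that copy by red edges. The "red cliques of the standard normal cover" are the members of $\mathcal S_c$, the "blue cliques" the members of $\mathcal C_c$. -}

module Defs where

open import Data.Nat using (ℕ; zero; suc; _+_; _∸_; _%_)
open import Data.Nat.DivMod using (_mod_)
open import Data.Fin using (Fin; toℕ) renaming (zero to f0; suc to fs)
import Data.Fin.Properties as FinP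
open import Data.Unit using (⊤; tt)
import Data.Unit.Properties as UnitP
open import Data.Empty using (⊥)
open import Data.Sum using (_⊎_; inj₁; inj₂)
import Data.Sum.Properties as SumP
open import Data.Product using (_×_; _,_; ∃)
import Data.Product.Properties as ProdP
open import Data.Maybe using (Maybe; just; nothing)
open import Data.List using (List; []; _∷_; map; concatMap; filter; length; allFin)
open import Relation.Nullary using (yes; no)
open import Data.List.Membership.Propositional using (_∈_)
import Data.List.Membership.DecPropositional as DecMem
open import Relation.Binary.PropositionalEquality using (_≡_)
open import Relation.Binary.Definitions using (DecidableEquality)
open import Data.Vec.Base using (Vec)
open import Data.Fin.Base using (Fin)

data Colour : Set where
  red blue : Colour

-- V 0 is empty (F_c is only defined for c ≥ 1).  F_2 : Fin 4 with 0 ↦ 0, 1 ↦ 1, 2 ↦ v₁, 3 ↦ v₂.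
-- F_{c+2} (c ≥ 1) : inj₁ X for the five new vertices X ∈ Fin 5
--   (0 = A, 1 = B, 2 = C, 3 = D, 4 = E), and inj₂ (Y , v) for the vertex v
--   of the copy F_c(Y).
V : ℕ → Set
V zero = ⊥
V (suc zero) = ⊤
V (suc (suc zero)) = Fin 4
V (suc (suc (suc c))) = Fin 5 ⊎ (Fin 5 × V (suc c))

diff5 : Fin 5 → Fin 5 → ℕ
diff5 i j = (5 + toℕ j ∸ toℕ i) % 5

shift5 : Fin 5 → ℕ → Fin 5
shift5 i n = (toℕ i + n) mod 5

-- colour between two pentagon vertices A..E: AB,BC,CD,DE,EA blue, others red
pentCol : ℕ → Maybe Colour
pentCol 1 = just blue
pentCol 4 = just blue
pentCol 2 = just red
pentCol 3 = just red
pentCol _ = nothing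

-- colour between pentagon vertex X and a vertex of copy F(Y), d = (X - Y) mod 5:
-- copy Y is blue to Y+2, Y+3 and red to Y+1, Y+4 (checked against the
-- definition: D ~ blue A,B red C,E; E ~ blue B,C red A,D; etc.)
copyCol : ℕ → Maybe Colour
copyCol 2 = just blue
copyCol 3 = just blue
copyCol 1 = just red
copyCol 4 = just red
copyCol _ = nothing

-- colour of the pair {x , y} in F_c (nothing = not joined)
col : (c : ℕ) → V c → V c → Maybe Colour
col zero () _
col (suc zero) _ _ = nothing
col (suc (suc zero)) f0 (fs (fs f0)) = just blue
col (suc (suc zero)) (fs (fs f0)) f0 = just blue
col (suc (suc zero)) (fs f0) (fs (fs (fs f0))) = just blue
col (suc (suc zero)) (fs (fs (fs f0))) (fs f0) = just blue
col (suc (suc zero)) f0 (fs (fs (fs f0))) = just red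
col (suc (suc zero)) (fs (fs (fs f0))) f0 = just red
col (suc (suc zero)) (fs f0) (fs (fs f0)) = just red
col (suc (suc zero)) (fs (fs f0)) (fs f0) = just red
col (suc (suc zero)) _ _ = nothing
col (suc (suc (suc c))) (inj₁ X) (inj₁ Y) = pentCol (diff5 X Y)
col (suc (suc (suc c))) (inj₁ X) (inj₂ (Y , v)) = copyCol (diff5 Y X)
col (suc (suc (suc c))) (inj₂ (Y , v)) (inj₁ X) = copyCol (diff5 Y X)
col (suc (suc (suc c))) (inj₂ (Y , v)) (inj₂ (Y' , w)) with Y FinP.≟ Y'
... | yes _ = col (suc c) v w
... | no _ = nothing

RedEdge : (c : ℕ) → V c → V c → Set
RedEdge c x y = col c x y ≡ just red

allFin5 : List (Fin 5)
allFin5 = allFin 5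

blueCover : (c : ℕ) → List (List (V c))
blueCover zero = []
blueCover (suc zero) = (tt ∷ []) ∷ []
blueCover (suc (suc zero)) = (f0 ∷ fs (fs f0) ∷ []) ∷ (fs f0 ∷ fs (fs (fs f0)) ∷ []) ∷ []
blueCover (suc (suc (suc c))) =
  concatMap (λ Y → map (λ Q → inj₁ (shift5 Y 2) ∷ inj₁ (shift5 Y 3) ∷ map (λ v → inj₂ (Y , v)) Q)
                       (blueCover (suc c)))
            allFin5

redCover : (c : ℕ) → List (List (V c))
redCover zero = []
redCover (suc zero) = (tt ∷ []) ∷ []
redCover (suc (suc zero)) = (f0 ∷ fs (fs (fs f0)) ∷ []) ∷ (fs f0 ∷ fs (fs f0) ∷ []) ∷ []
redCover (suc (suc (suc c))) =
  concatMap (λ Y → map (λ R → inj₁ (shift5 Y 1) ∷ inj₁ (shift5 Y 4) ∷ map (λ v → inj₂ (Y , v)) R)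
                       (redCover (suc c)))
            allFin5

_≟V_ : {c : ℕ} → DecidableEquality (V c)
_≟V_ {zero} ()
_≟V_ {suc zero} = UnitP._≟_
_≟V_ {suc (suc zero)} = FinP._≟_
_≟V_ {suc (suc (suc c))} = SumP.≡-dec FinP._≟_ (ProdP.≡-dec FinP._≟_ (_≟V_ {suc c}))

-- number of elements of the list U that lie in Q  (= |U ∩ Q| when U has no repeats)
common : (c : ℕ) → List (V c) → List (V c) → ℕ
common c U Q = length (filter (λ x → x ∈? Q) U)
  where open DecMem (_≟V_ {c}) using (_∈?_)

module Submission where

-- We prove, by induction on c in steps of two, the stronger
-- claim (Bound): every duplicate-free, red-independent list U of vertices of
-- F_c meeting all red cliques of S_c has at least c vertices, and if it has
-- at most c vertices then it shares c − 1 vertices with a blue clique of C_c.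
--
-- For F_{c+2}, write U as its pentagon part (vertices among A,…,E) and its
-- traces on the five copies F_c(Y).  The red edges of the pentagon form the
-- pentagram, so the pentagon part of U is empty, a single vertex X, or an
-- adjacent pair {Y+2, Y+3}.  A copy Y is "free" when Y+1, Y+4 ∉ U; then the
-- trace on F_c(Y) meets every red clique of F_c (the red cliques through the
-- copy are exactly R ∪ {Y+1, Y+4}), so the induction hypothesis applies.
--   * empty part: all five copies are free, |U| ≥ 5c > c + 2;
--   * single vertex X: the copies X, X+2, X+3 are free, |U| ≥ 1 + 3c > c + 2;
--   * pair {Y+2, Y+3}: copy Y is free, so |U| ≥ 2 + c, and if |U| ≤ c + 2
--     the blue clique Q ∪ {Y+2, Y+3} built from the inductive Q works.

open import Defs
open import Data.Nat using (ℕ; zero; suc; _+_; _*_; _≤_; _<_; _∸_; _%_; z≤n; s≤s; NonZero)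
open import Data.Nat.Properties using (≤-trans; ≤-reflexive; ≤-antisym; ≤-pred; +-mono-≤; +-monoʳ-≤; +-monoˡ-≤; +-suc; +-assoc; +-comm; +-identityʳ; m≤m+n; m≤n+m; *-suc; <⇒≤; <⇒≱; module ≤-Reasoning)
open import Data.Nat.DivMod using (_mod_; m%n<n; %-distribˡ-+; m%n%n≡m%n; m<n⇒m%n≡m)
open import Data.Fin using (Fin; toℕ) renaming (zero to f0; suc to fs)
open import Data.Fin.Properties using (toℕ-injective; toℕ-fromℕ<; fromℕ<-cong; toℕ<n) renaming (_≟_ to _≟F_)
open import Data.List using (List; []; _∷_; length; map)
open import Data.Nat.ListAction using (sum)
open import Data.List.Properties using (length-map; length-removeAt′)
open import Data.List.Membership.Propositional using (_∈_; _∉_; _─_; lose)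
open import Data.List.Membership.Propositional.Properties using (∈-map⁺; ∈-map⁻; ∈-filter⁺; ∈-filter⁻; ∈-allFin; ∈-concatMap⁺; ∈-length)
import Data.List.Membership.DecPropositional as DecMem
open import Data.List.Relation.Unary.Any as Any using (here; there; index; any?; satisfied)
open import Data.List.Relation.Unary.All as All using (All; []; _∷_)
open import Data.List.Relation.Unary.All.Properties using (map⁺)
open import Data.List.Relation.Unary.AllPairs using ([]; _∷_)
open import Data.List.Relation.Unary.Unique.Propositional using (Unique)
import Data.List.Relation.Unary.Unique.Propositional.Properties as Unique
open import Data.Product using (_×_; ∃; _,_; proj₁; proj₂)
open import Data.Sum using (inj₁; inj₂)
open import Data.Sum.Properties using (inj₁-injective)
open import Data.Unit using (tt)
open import Data.Empty using (⊥-elim)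
open import Function using (_∘_)
open import Relation.Nullary using (¬_; Dec; yes; no)
open import Relation.Binary.PropositionalEquality using (_≡_; _≢_; refl; sym; trans; cong; cong₂; subst; module ≡-Reasoning)

module _ {A : Set} where

  ∈-─ : ∀ {x z : A} {xs} (x∈xs : x ∈ xs) → z ∈ xs → x ≢ z → z ∈ xs ─ x∈xs
  ∈-─ (here refl)  (here refl)  x≢z = ⊥-elim (x≢z refl)
  ∈-─ (here _)     (there z∈xs) _   = z∈xs
  ∈-─ (there _)    (here refl)  _   = here refl
  ∈-─ (there x∈xs) (there z∈xs) x≢z = there (∈-─ x∈xs z∈xs x≢z)

  unique-⊆⇒length≤ : ∀ {xs ys : List A} → Unique xs → (∀ {z} → z ∈ xs → z ∈ ys) →
                     length xs ≤ length ys
  unique-⊆⇒length≤ {[]} _ _ = z≤n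
  unique-⊆⇒length≤ {x ∷ xs} {ys} (x∉xs ∷ uxs) xs⊆ys = begin
    suc (length xs)         ≤⟨ s≤s (unique-⊆⇒length≤ uxs xs⊆ys─x) ⟩
    suc (length (ys ─ x∈ys)) ≡⟨ sym (length-removeAt′ ys (index x∈ys)) ⟩
    length ys               ∎
    where
    open ≤-Reasoning
    x∈ys : x ∈ ys
    x∈ys = xs⊆ys (here refl)
    xs⊆ys─x : ∀ {z} → z ∈ xs → z ∈ ys ─ x∈ys
    xs⊆ys─x z∈xs = ∈-─ x∈ys (xs⊆ys (there z∈xs)) (All.lookup x∉xs z∈xs)

  distinct-members : ∀ {x y : A} {xs} → x ∈ xs → y ∈ xs → x ≢ y → 2 ≤ length xs
  distinct-members {x} {y} x∈ y∈ x≢y = unique-⊆⇒length≤ ((x≢y ∷ []) ∷ [] ∷ []) pair⊆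
    where
    pair⊆ : ∀ {z} → z ∈ x ∷ y ∷ [] → z ∈ _
    pair⊆ (here refl)         = x∈
    pair⊆ (there (here refl)) = y∈

  sum-map-≥ : ∀ {k} (f : A → ℕ) (xs : List A) → (∀ {x} → x ∈ xs → k ≤ f x) →
              length xs * k ≤ sum (map f xs)
  sum-map-≥ f []       _   = z≤n
  sum-map-≥ f (x ∷ xs) k≤f = +-mono-≤ (k≤f (here refl)) (sum-map-≥ f xs (k≤f ∘ there))

-- Arithmetic on the pentagon: Fin 5 with addition mod 5 (shift5 X k = X + k)

%-absorbˡ : ∀ m n d .{{_ : NonZero d}} → (m % d + n) % d ≡ (m + n) % d
%-absorbˡ m n d = begin
  (m % d + n) % d         ≡⟨ %-distribˡ-+ (m % d) n d ⟩
  (m % d % d + n % d) % d ≡⟨ cong (λ k → (k + n % d) % d) (m%n%n≡m%n m d) ⟩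
  (m % d + n % d) % d     ≡⟨ %-distribˡ-+ m n d ⟨
  (m + n) % d             ∎
  where open ≡-Reasoning

%-absorbʳ : ∀ m n d .{{_ : NonZero d}} → (m + n % d) % d ≡ (m + n) % d
%-absorbʳ m n d = begin
  (m + n % d) % d ≡⟨ cong (_% d) (+-comm m (n % d)) ⟩
  (n % d + m) % d ≡⟨ %-absorbˡ n m d ⟩
  (n + m) % d     ≡⟨ cong (_% d) (+-comm n m) ⟩
  (m + n) % d     ∎
  where open ≡-Reasoning

-- Shifting twice is shifting by the sum; closed instances such as
-- (X + 3) + 4 = X + 2 follow by evaluating (3 + 4) % 5.
shift5-shift5 : ∀ X a b → shift5 (shift5 X a) b ≡ shift5 X ((a + b) % 5)
shift5-shift5 X a b = fromℕ<-cong _ _ toℕ-eq _ _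
  where
  open ≡-Reasoning
  x = toℕ X
  toℕ-eq : (toℕ (shift5 X a) + b) % 5 ≡ (x + (a + b) % 5) % 5
  toℕ-eq = begin
    (toℕ ((x + a) mod 5) + b) % 5 ≡⟨ cong (λ k → (k + b) % 5) (toℕ-fromℕ< (m%n<n (x + a) 5)) ⟩
    ((x + a) % 5 + b) % 5         ≡⟨ %-absorbˡ (x + a) b 5 ⟩
    (x + a + b) % 5               ≡⟨ cong (_% 5) (+-assoc x a b) ⟩
    (x + (a + b)) % 5             ≡⟨ %-absorbʳ x (a + b) 5 ⟨
    (x + (a + b) % 5) % 5         ∎

shift5-zero : ∀ X → shift5 X 0 ≡ X
shift5-zero X = toℕ-injective (begin
  toℕ ((toℕ X + 0) mod 5) ≡⟨ toℕ-fromℕ< _ ⟩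
  (toℕ X + 0) % 5         ≡⟨ cong (_% 5) (+-identityʳ (toℕ X)) ⟩
  toℕ X % 5               ≡⟨ m<n⇒m%n≡m (toℕ<n X) ⟩
  toℕ X                   ∎)
  where open ≡-Reasoning

rotate1-moves : ∀ X → shift5 X 1 ≢ X
rotate1-moves f0 ()
rotate1-moves (fs f0) ()
rotate1-moves (fs (fs f0)) ()
rotate1-moves (fs (fs (fs f0))) ()
rotate1-moves (fs (fs (fs (fs f0)))) ()

rotate2-moves : ∀ X → shift5 X 2 ≢ X
rotate2-moves f0 ()
rotate2-moves (fs f0) ()
rotate2-moves (fs (fs f0)) ()
rotate2-moves (fs (fs (fs f0))) ()
rotate2-moves (fs (fs (fs (fs f0)))) ()

rotate3-moves : ∀ X → shift5 X 3 ≢ X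
rotate3-moves f0 ()
rotate3-moves (fs f0) ()
rotate3-moves (fs (fs f0)) ()
rotate3-moves (fs (fs (fs f0))) ()
rotate3-moves (fs (fs (fs (fs f0)))) ()

_∈V?_ : ∀ {c} (x : V c) (Q : List (V c)) → Dec (x ∈ Q)
x ∈V? Q = DecMem._∈?_ _≟V_ x Q

record Transversal (c : ℕ) (U : List (V c)) : Set where
  field
    unique      : Unique U
    independent : ∀ {x y} → x ∈ U → y ∈ U → ¬ RedEdge c x y
    meets       : ∀ {S} → S ∈ redCover c → ∃ λ x → x ∈ U × x ∈ S

NearBlue : (c : ℕ) → List (V c) → Set
NearBlue c U = ∃ λ Q → Q ∈ blueCover c × c ∸ 1 ≤ common c U Q

Bound : (c : ℕ) → List (V c) → Set
Bound c U = c ≤ length U × (length U ≤ c → NearBlue c U)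

-- Structure of F_{c+2} for c = suc m: the pentagon and the five copies F_c(Y)

module Blowup (m : ℕ) where

  c n : ℕ
  c = suc m
  n = suc (suc c)

  embed : Fin 5 → V c → V n
  embed Y v = inj₂ (Y , v)

  pent : List (V n) → List (Fin 5)
  pent []           = []
  pent (inj₁ X ∷ U) = X ∷ pent U
  pent (inj₂ _ ∷ U) = pent U

  copy : Fin 5 → List (V n) → List (V c)
  copy Y [] = []
  copy Y (inj₁ _ ∷ U) = copy Y U
  copy Y (inj₂ (Y' , v) ∷ U) with Y ≟F Y'
  ... | yes _ = v ∷ copy Y U
  ... | no _  = copy Y U

  pent-∈⁺ : ∀ {X} U → inj₁ X ∈ U → X ∈ pent U
  pent-∈⁺ (inj₁ X ∷ U) (here refl) = here refl
  pent-∈⁺ (inj₁ _ ∷ U) (there p)   = there (pent-∈⁺ U p)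
  pent-∈⁺ (inj₂ _ ∷ U) (there p)   = pent-∈⁺ U p

  copy-∈⁻ : ∀ {Y v} U → v ∈ copy Y U → embed Y v ∈ U
  copy-∈⁻ (inj₁ _ ∷ U) p = there (copy-∈⁻ U p)
  copy-∈⁻ {Y} (inj₂ (Y' , w) ∷ U) p with Y ≟F Y' | p
  ... | yes refl | here refl = here refl
  ... | yes refl | there q   = there (copy-∈⁻ U q)
  ... | no _     | q         = there (copy-∈⁻ U q)

  copy-∈⁺ : ∀ {Y v} U → embed Y v ∈ U → v ∈ copy Y U
  copy-∈⁺ (inj₁ _ ∷ U) (there p) = copy-∈⁺ U p
  copy-∈⁺ {Y} (inj₂ (Y' , w) ∷ U) p with Y ≟F Y' | p
  ... | yes refl | here refl = here refl
  ... | yes refl | there q   = there (copy-∈⁺ U q)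
  ... | no Y≢Y'  | here refl = ⊥-elim (Y≢Y' refl)
  ... | no _     | there q   = copy-∈⁺ U q

  copy-other : ∀ {Y Y'} v U → Y' ≢ Y → copy Y (embed Y' v ∷ U) ≡ copy Y U
  copy-other {Y} {Y'} v U Y'≢Y with Y ≟F Y'
  ... | yes Y≡Y' = ⊥-elim (Y'≢Y (sym Y≡Y'))
  ... | no _     = refl

  copy-unique : ∀ Y {U} → Unique U → Unique (copy Y U)
  copy-unique Y {[]} _ = []
  copy-unique Y {inj₁ _ ∷ U} (_ ∷ uU) = copy-unique Y uU
  copy-unique Y {inj₂ (Y' , w) ∷ U} (w∉U ∷ uU) with Y ≟F Y'
  ... | yes refl = All.tabulate (λ v∈ w≡v → All.lookup w∉U (copy-∈⁻ U v∈) (cong (embed Y) w≡v))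
                   ∷ copy-unique Y uU
  ... | no _     = copy-unique Y uU

  col-copy : ∀ Y v w → col n (embed Y v) (embed Y w) ≡ col c v w
  col-copy Y v w with Y ≟F Y
  ... | yes _   = refl
  ... | no Y≢Y = ⊥-elim (Y≢Y refl)

  pentagram-red : ∀ X → RedEdge n (inj₁ X) (inj₁ (shift5 X 2))
  pentagram-red f0 = refl
  pentagram-red (fs f0) = refl
  pentagram-red (fs (fs f0)) = refl
  pentagram-red (fs (fs (fs f0))) = refl
  pentagram-red (fs (fs (fs (fs f0)))) = refl

  redClique blueClique : Fin 5 → List (V c) → List (V n)
  redClique  Y R = inj₁ (shift5 Y 1) ∷ inj₁ (shift5 Y 4) ∷ map (embed Y) R
  blueClique Y Q = inj₁ (shift5 Y 2) ∷ inj₁ (shift5 Y 3) ∷ map (embed Y) Q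

  redClique-∈ : ∀ Y {R} → R ∈ redCover c → redClique Y R ∈ redCover n
  redClique-∈ Y R∈ = ∈-concatMap⁺ (λ Y → map (redClique Y) (redCover c)) (Any.map (λ where refl → ∈-map⁺ (redClique Y) R∈) (∈-allFin Y))

  blueClique-∈ : ∀ Y {Q} → Q ∈ blueCover c → blueClique Y Q ∈ blueCover n
  blueClique-∈ Y Q∈ = ∈-concatMap⁺ (λ Y → map (blueClique Y) (blueCover c)) (Any.map (λ where refl → ∈-map⁺ (blueClique Y) Q∈) (∈-allFin Y))

  blueClique-unique : ∀ Y {L} → Unique L → Unique (blueClique Y L)
  blueClique-unique Y {L} uL =
    (Y+2≢Y+3 ∷ not-pentagon) ∷ not-pentagon ∷ Unique.map⁺ embed-injective uL
    where
    Y+2≢Y+3 : inj₁ (shift5 Y 2) ≢ inj₁ (shift5 Y 3)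
    Y+2≢Y+3 eq = rotate1-moves (shift5 Y 2) (trans (shift5-shift5 Y 2 1) (sym (inj₁-injective eq)))
    not-pentagon : ∀ {X} → All (inj₁ X ≢_) (map (embed Y) L)
    not-pentagon = map⁺ (All.universal (λ _ ()) L)
    embed-injective : ∀ {v w} → embed Y v ≡ embed Y w → v ≡ w
    embed-injective refl = refl

  blueClique-count : ∀ Y {L : List (V c)} {X : List (V n)} → Unique L →
    inj₁ (shift5 Y 2) ∈ X → inj₁ (shift5 Y 3) ∈ X → (∀ {v} → v ∈ L → embed Y v ∈ X) →
    2 + length L ≤ length X
  blueClique-count Y {L} {X} uL a∈X b∈X L⊆X =
    subst (_≤ length X) (cong (2 +_) (length-map (embed Y) L))
      (unique-⊆⇒length≤ (blueClique-unique Y uL) clique⊆X)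
    where
    clique⊆X : ∀ {z} → z ∈ blueClique Y L → z ∈ _
    clique⊆X (here refl)         = a∈X
    clique⊆X (there (here refl)) = b∈X
    clique⊆X (there (there z∈)) with ∈-map⁻ (embed Y) z∈
    ... | v , v∈L , refl = L⊆X v∈L

  -- Copy Y is free for U when neither pentagon vertex of its red cliques is in U.
  Free : List (V n) → Fin 5 → Set
  Free U Y = inj₁ (shift5 Y 1) ∉ U × inj₁ (shift5 Y 4) ∉ U

  restrict : ∀ {U Y} → Transversal n U → Free U Y → Transversal c (copy Y U)
  restrict {U} {Y} T (Y+1∉U , Y+4∉U) = record
    { unique      = copy-unique Y unique
    ; independent = λ v∈ w∈ red → independent (copy-∈⁻ U v∈) (copy-∈⁻ U w∈) (trans (col-copy Y _ _) red)
    ; meets       = meets-copy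
    }
    where
    open Transversal T
    meets-copy : ∀ {R} → R ∈ redCover c → ∃ λ v → v ∈ copy Y U × v ∈ R
    meets-copy R∈ with meets (redClique-∈ Y R∈)
    ... | _ , x∈U , here refl         = ⊥-elim (Y+1∉U x∈U)
    ... | _ , x∈U , there (here refl) = ⊥-elim (Y+4∉U x∈U)
    ... | _ , x∈U , there (there x∈)  with ∈-map⁻ (embed Y) x∈
    ...   | v , v∈R , refl = v , copy-∈⁺ U x∈U , v∈R

  copyMass : List (Fin 5) → List (V n) → ℕ
  copyMass Ys U = sum (map (λ Y → length (copy Y U)) Ys)

  copyMass-[] : ∀ Ys → copyMass Ys [] ≡ 0
  copyMass-[] []       = refl
  copyMass-[] (_ ∷ Ys) = copyMass-[] Ys

  copyMass-other : ∀ {Ys Y'} v U → All (Y' ≢_) Ys → copyMass Ys (embed Y' v ∷ U) ≡ copyMass Ys U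
  copyMass-other v U [] = refl
  copyMass-other v U (Y'≢Y ∷ Y'∉Ys) =
    cong₂ _+_ (cong length (copy-other v U Y'≢Y)) (copyMass-other v U Y'∉Ys)

  copyMass-cons : ∀ {Ys} → Unique Ys → ∀ Y' v U → copyMass Ys (embed Y' v ∷ U) ≤ suc (copyMass Ys U)
  copyMass-cons [] _ _ _ = z≤n
  copyMass-cons {Y ∷ _} (Y∉Ys ∷ uYs) Y' v U with Y ≟F Y'
  ... | yes refl = ≤-reflexive (cong (suc ∘ (length (copy Y U) +_)) (copyMass-other v U Y∉Ys))
  ... | no _     = ≤-trans (+-monoʳ-≤ (length (copy Y U)) (copyMass-cons uYs Y' v U))
                           (≤-reflexive (+-suc _ _))

  count-bound : ∀ {Ys} → Unique Ys → ∀ U → length (pent U) + copyMass Ys U ≤ length U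
  count-bound {Ys} _ [] = ≤-reflexive (copyMass-[] Ys)
  count-bound uYs (inj₁ _ ∷ U) = s≤s (count-bound uYs U)
  count-bound {Ys} uYs (inj₂ (Y' , v) ∷ U) = begin
    length (pent U) + copyMass Ys (embed Y' v ∷ U) ≤⟨ +-monoʳ-≤ (length (pent U)) (copyMass-cons uYs Y' v U) ⟩
    length (pent U) + suc (copyMass Ys U)         ≡⟨ +-suc _ _ ⟩
    suc (length (pent U) + copyMass Ys U)         ≤⟨ s≤s (count-bound uYs U) ⟩
    suc (length U)                                ∎
    where open ≤-Reasoning

module Step (m : ℕ) (ih : ∀ U → Transversal (suc m) U → Bound (suc m) U) where
  open Blowup m

  n<1+3c : n < 1 + 3 * c
  n<1+3c = begin
    4 + m     ≤⟨ +-monoʳ-≤ 4 (m≤m+n m (2 * m)) ⟩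
    4 + 3 * m ≡⟨ cong suc (*-suc 3 m) ⟨
    1 + 3 * c ∎
    where open ≤-Reasoning

  1+3c≤5c : 1 + 3 * c ≤ 5 * c
  1+3c≤5c = ≤-trans (+-monoˡ-≤ (3 * c) (s≤s z≤n)) (+-monoʳ-≤ c (m≤n+m (3 * c) c))

  module _ {U : List (V n)} (T : Transversal n U) where
    open Transversal T

    present : ∀ {Z W} → Z ≡ W → inj₁ W ∈ U → inj₁ Z ∈ U
    present refl W∈U = W∈U

    absent : ∀ {Z W} → Z ≡ W → inj₁ W ∉ U → inj₁ Z ∉ U
    absent refl W∉U = W∉U

    gap2-excluded : ∀ X → inj₁ X ∈ U → inj₁ (shift5 X 2) ∉ U
    gap2-excluded X X∈U X+2∈U = independent X∈U X+2∈U (pentagram-red X)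

    gap3-excluded : ∀ X → inj₁ X ∈ U → inj₁ (shift5 X 3) ∉ U
    gap3-excluded X X∈U X+3∈U =
      gap2-excluded (shift5 X 3) X+3∈U (present (trans (shift5-shift5 X 3 2) (shift5-zero X)) X∈U)

    copy-bound : ∀ Y → Free U Y → Bound c (copy Y U)
    copy-bound Y free = ih (copy Y U) (restrict T free)

    oversized : 1 + 3 * c ≤ length U → Bound n U
    oversized big = <⇒≤ n<U , λ U≤n → ⊥-elim (<⇒≱ n<U U≤n)
      where n<U = ≤-trans n<1+3c big

    -- Pentagon part {Y+2, Y+3}: the blue clique through copy Y extends the
    -- clique found in the trace on F_c(Y).
    pair-case : ∀ Y → inj₁ (shift5 Y 2) ∈ U → inj₁ (shift5 Y 3) ∈ U → Free U Y → Bound n U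
    pair-case Y a∈U b∈U free = ≤-trans (s≤s (s≤s c≤W)) 2+W≤U , near-blue
      where
      W = copy Y U
      uW = copy-unique Y unique
      c≤W = proj₁ (copy-bound Y free)
      2+W≤U : 2 + length W ≤ length U
      2+W≤U = blueClique-count Y uW a∈U b∈U (copy-∈⁻ U)
      near-blue : length U ≤ n → NearBlue n U
      near-blue U≤n with proj₂ (copy-bound Y free) (≤-pred (≤-pred (≤-trans 2+W≤U U≤n)))
      ... | Q , Q∈ , near = blueClique Y Q , blueClique-∈ Y Q∈ , ≤-trans (s≤s (s≤s near)) common-count
        where
        common-count : 2 + common c W Q ≤ common n U (blueClique Y Q)
        common-count = blueClique-count Y (Unique.filter⁺ (_∈V? Q) uW)
          (∈-filter⁺ (_∈V? blueClique Y Q) a∈U (here refl))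
          (∈-filter⁺ (_∈V? blueClique Y Q) b∈U (there (here refl)))
          (λ v∈ → let v∈W , v∈Q = ∈-filter⁻ (_∈V? Q) v∈
                  in ∈-filter⁺ (_∈V? blueClique Y Q) (copy-∈⁻ U v∈W) (there (there (∈-map⁺ (embed Y) v∈Q))))

    -- Pentagon part {X}: copies X, X+2, X+3 are free, so |U| ≥ 1 + 3c.
    single-case : ∀ X → inj₁ X ∈ U → inj₁ (shift5 X 1) ∉ U → inj₁ (shift5 X 4) ∉ U → Bound n U
    single-case X X∈U X+1∉U X+4∉U = oversized (begin
      1 + 3 * c                          ≤⟨ +-mono-≤ (∈-length (pent-∈⁺ U X∈U)) (sum-map-≥ _ Ys c≤copy) ⟩
      length (pent U) + copyMass Ys U    ≤⟨ count-bound uYs U ⟩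
      length U                           ∎)
      where
      open ≤-Reasoning
      Ys = X ∷ shift5 X 2 ∷ shift5 X 3 ∷ []
      uYs : Unique Ys
      uYs = ((rotate2-moves X ∘ sym) ∷ (rotate3-moves X ∘ sym) ∷ [])
          ∷ ((λ eq → rotate1-moves (shift5 X 2) (trans (shift5-shift5 X 2 1) (sym eq))) ∷ [])
          ∷ [] ∷ []
      X+2∉U = gap2-excluded X X∈U
      X+3∉U = gap3-excluded X X∈U
      c≤copy : ∀ {Y} → Y ∈ Ys → c ≤ length (copy Y U)
      c≤copy (here refl) = proj₁ (copy-bound X (X+1∉U , X+4∉U))
      c≤copy (there (here refl)) = proj₁ (copy-bound (shift5 X 2)
        (absent (shift5-shift5 X 2 1) X+3∉U , absent (shift5-shift5 X 2 4) X+1∉U))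
      c≤copy (there (there (here refl))) = proj₁ (copy-bound (shift5 X 3)
        (absent (shift5-shift5 X 3 1) X+4∉U , absent (shift5-shift5 X 3 4) X+2∉U))

    -- No pentagon vertex: all five copies are free, so |U| ≥ 5c.
    no-pentagon : (∀ X → inj₁ X ∉ U) → Bound n U
    no-pentagon none = oversized (begin
      1 + 3 * c                               ≤⟨ 1+3c≤5c ⟩
      5 * c                                   ≤⟨ sum-map-≥ _ allFin5 (λ {Y} _ → proj₁ (copy-bound Y (none _ , none _))) ⟩
      copyMass allFin5 U                      ≤⟨ m≤n+m (copyMass allFin5 U) (length (pent U)) ⟩
      length (pent U) + copyMass allFin5 U    ≤⟨ count-bound (Unique.allFin⁺ 5) U ⟩
      length U                                ∎)
      where open ≤-Reasoning

    -- Pentagon vertex X ∈ U: its pentagon part is {X}, {X, X+1} or {X+4, X}.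
    from-vertex : ∀ X → inj₁ X ∈ U → Bound n U
    from-vertex X X∈U with inj₁ (shift5 X 1) ∈V? U | inj₁ (shift5 X 4) ∈V? U
    ... | yes X+1∈U | yes X+4∈U =
      ⊥-elim (gap2-excluded (shift5 X 4) X+4∈U (present (shift5-shift5 X 4 2) X+1∈U))
    ... | yes X+1∈U | no X+4∉U = pair-case (shift5 X 3)
      (present (trans (shift5-shift5 X 3 2) (shift5-zero X)) X∈U)
      (present (shift5-shift5 X 3 3) X+1∈U)
      (absent (shift5-shift5 X 3 1) X+4∉U , absent (shift5-shift5 X 3 4) (gap2-excluded X X∈U))
    ... | no X+1∉U | yes X+4∈U = pair-case (shift5 X 2)
      (present (shift5-shift5 X 2 2) X+4∈U)
      (present (trans (shift5-shift5 X 2 3) (shift5-zero X)) X∈U)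
      (absent (shift5-shift5 X 2 1) (gap3-excluded X X∈U) , absent (shift5-shift5 X 2 4) X+1∉U)
    ... | no X+1∉U | no X+4∉U = single-case X X∈U X+1∉U X+4∉U

    step : Bound n U
    step with any? (λ X → inj₁ X ∈V? U) allFin5
    ... | yes some = from-vertex (proj₁ (satisfied some)) (proj₂ (satisfied some))
    ... | no none  = no-pentagon (λ X X∈U → none (lose (∈-allFin X) X∈U))

base1 : ∀ U → Transversal 1 U → Bound 1 U
base1 U T with Transversal.meets T (here refl)
... | _ , x∈U , _ = ∈-length x∈U , λ _ → (tt ∷ []) , here refl , z≤n

-- In F_2 the red cliques {0, v₂} and {1, v₁} are disjoint, and each vertex
-- of {0, v₂} lies in a blue clique.
base2 : ∀ U → Transversal 2 U → Bound 2 U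
base2 U T with Transversal.meets T (here refl) | Transversal.meets T (there (here refl))
... | x , x∈U , x∈S | y , y∈U , y∈S = distinct-members x∈U y∈U (disjoint x∈S y∈S) , λ _ → near-blue x∈U x∈S
  where
  S₀ S₁ : List (V 2)
  S₀ = f0 ∷ fs (fs (fs f0)) ∷ []
  S₁ = fs f0 ∷ fs (fs f0) ∷ []
  disjoint : ∀ {x y} → x ∈ S₀ → y ∈ S₁ → x ≢ y
  disjoint (here refl)         (here refl)         ()
  disjoint (here refl)         (there (here refl)) ()
  disjoint (there (here refl)) (here refl)         ()
  disjoint (there (here refl)) (there (here refl)) ()
  near-blue : ∀ {x} → x ∈ U → x ∈ S₀ → NearBlue 2 U
  near-blue x∈U (here refl) =
    _ , here refl , ∈-length (∈-filter⁺ (_∈V? _) x∈U (here refl))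
  near-blue x∈U (there (here refl)) =
    _ , there (here refl) , ∈-length (∈-filter⁺ (_∈V? _) x∈U (there (here refl)))

bound : ∀ m U → Transversal (suc m) U → Bound (suc m) U
bound zero          = base1
bound (suc zero)    = base2
bound (suc (suc m)) U = Step.step m (bound m)

proposition2 : (c : ℕ) → 1 ≤ c → (U : List (V c)) → Unique U → length U ≤ c →
    (∀ {x y} → x ∈ U → y ∈ U → ¬ RedEdge c x y) →
    (∀ {S} → S ∈ redCover c → ∃ λ x → x ∈ U × x ∈ S) →
    length U ≡ c × ∃ λ Q → Q ∈ blueCover c × c ∸ 1 ≤ common c U Q
proposition2 (suc m) _ U uU U≤c indep meets =
  ≤-antisym U≤c (proj₁ claim) , proj₂ claim U≤c
  where
  claim : Bound (suc m) U
  claim = bound m U (record { unique = uU ; independent = indep ; meets = meets })
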